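{- Let $\varphi \in \mu LTL$. (i) The deterministic Büchi automaton $\mathcal{A}_\mu^\varphi = (\mathit{Reach}(\varphi), \mathit{af}, \varphi, \mathrm{inf}(\{\mathbf{tt}\}))$ over $2^{Ap}$ recognizes $L(\varphi)$. (ii) The deterministic Büchi automaton $\mathcal{A}_{\mathbf{GF}\mu}^\varphi = (\mathit{Reach}(\mathbf{F}\varphi), \mathit{af}_{\mathbf{F}\varphi}, \mathbf{F}\varphi, \mathrm{inf}(\{\mathbf{tt}\}))$ recognizes $L(\mathbf{G}\mathbf{F}\varphi)$, where $\mathit{af}_{\mathbf{F}\varphi}(\psi,\nu) = \mathbf{F}\varphi$ if $\psi \equiv_P \mathbf{tt}$ and $\mathit{af}_{\mathbf{F}\varphi}(\psi,\nu)=\mathit{af}(\psi,\nu)$ otherwise. Let $\varphi \in \nu LTL$. (iii) The deterministic coBüchi automaton $\mathcal{A}_\nu^\varphi = (\mathit{Reach}(\varphi), \mathit{af}, \varphi, \mathrm{fin}(\{\mathbf{ff}\}))$ recognizes $L(\varphi)$. (iv) The deterministic coBüchi automaton $\mathcal{A}_{\mathbf{FG}\nu}^\varphi = (\mathit{Reach}(\mathbf{G}\varphi), \mathit{af}_{\mathbf{G}\varphi}, \mathbf{G}\varphi, \mathrm{fin}(\{\mathbf{ff}\}))$ recognizes $L(\mathbf{F}\mathbf{G}\varphi)$, where $\mathit{af}_{\mathbf{G}\varphi}(\psi,\nu) = \mathbf{G}\varphi$ if $\psi \equiv_P \mathbf{ff}$ and $\mathit{af}_{\mathbf{G}\varphi}(\psi,\nu)=\mathit{af}(\psi,\nu)$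 otherwise.
   Context: LTL formulas in negation normal form over a finite set $Ap$: $\varphi ::= \mathbf{tt} \mid \mathbf{ff} \mid a \mid \neg a \mid \varphi\wedge\varphi \mid \varphi\vee\varphi \mid \mathbf{X}\varphi \mid \mathbf{F}\varphi \mid \mathbf{G}\varphi \mid \varphi\mathbf{U}\varphi \mid \varphi\mathbf{W}\varphi \mid \varphi\mathbf{M}\varphi \mid \varphi\mathbf{R}\varphi$, with standard semantics on infinite words over $2^{Ap}$ ($\varphi\mathbf{W}\psi\equiv\mathbf{G}\varphi\vee\varphi\mathbf{U}\psi$; $w\models\varphi\mathbf{M}\psi$ iff $\exists k.\,w_k\models\varphi \wedge \forall j\le k.\,w_j\models\psi$; $\varphi\mathbf{R}\psi\equiv\mathbf{G}\psi\vee\varphi\mathbf{M}\psi$). $L(\varphi)$ is the set of words satisfying $\varphi$. $\mu LTL$ is the fragment using only $\mathbf{tt},\mathbf{ff},a,\neg a,\wedge,\vee,\mathbf{X},\mathbf{F},\mathbf{U},\mathbf{M}$; $\nu LTL$ the fragment using only $\mathbf{tt},\mathbf{ff},a,\neg a,\wedge,\vee,\mathbf{X},\mathbf{G},\mathbf{W},\mathbf{R}$. A subformula is proper if its top symbol is not $\wedge$ or $\vee$. Two formulas are propositionally equivalent ($\equiv_P$) if, after replacing every maximal proper subformula $\psi$ by a propositional variable $x_\psi$, the resulting propositional formulas are equivalent; $[\varphi]_P$ is the class of $\varphi$. The function $\mathit{af}$: for a letter $\nu\in 2^{Ap}$, $\mathit{af}(a,\nu)=\mathbf{tt}$ if $a\in\nu$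 else $\mathbf{ff}$; $\mathit{af}(\neg a,\nu)=\mathbf{ff}$ if $a\in\nu$ else $\mathbf{tt}$; $\mathit{af}(\mathbf{tt},\nu)=\mathbf{tt}$, $\mathit{af}(\mathbf{ff},\nu)=\mathbf{ff}$; $\mathit{af}$ commutes with $\wedge,\vee$; $\mathit{af}(\mathbf{X}\varphi,\nu)=\varphi$; $\mathit{af}(\mathbf{F}\varphi,\nu)=\mathit{af}(\varphi,\nu)\vee\mathbf{F}\varphi$; $\mathit{af}(\mathbf{G}\varphi,\nu)=\mathit{af}(\varphi,\nu)\wedge\mathbf{G}\varphi$; $\mathit{af}(\varphi\mathbf{U}\psi,\nu)=\mathit{af}(\psi,\nu)\vee(\mathit{af}(\varphi,\nu)\wedge\varphi\mathbf{U}\psi)$, same shape for $\mathbf{W}$; $\mathit{af}(\varphi\mathbf{M}\psi,\nu)=\mathit{af}(\psi,\nu)\wedge(\mathit{af}(\varphi,\nu)\vee\varphi\mathbf{M}\psi)$, same shape for $\mathbf{R}$; extended to finite words by $\mathit{af}(\varphi,\epsilon)=\varphi$, $\mathit{af}(\varphi,\nu u)=\mathit{af}(\mathit{af}(\varphi,\nu),u)$. $\mathit{af}$ respects $\equiv_P$ and is applied to equivalence classes. $\mathit{Reach}(\varphi)=\{[\mathit{af}(\varphi,u)]_P \mid u\in(2^{Ap})^*\}$. An automaton is written as (set of states, transition function, initial state, acceptance condition); states are $\equiv_P$-classes. A run is accepting under $\mathrm{inf}(S)$ if it visits $S$ infinitely often, and under $\mathrm{fin}(S)$ if it visits $S$ only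 finitely often; $\mathbf{tt}$, $\mathbf{ff}$ denote the states $[\mathbf{tt}]_P$, $[\mathbf{ff}]_P$. -}

module Defs where

open import Level using (0ℓ)
open import Data.Nat using (ℕ; zero; suc; _+_; _≤_; _<_)
open import Data.Bool using (Bool; true; false; if_then_else_)
import Data.Bool as B
open import Data.List using (List; []; _∷_)
open import Data.Product using (Σ; ∃; _×_; _,_)
open import Data.Sum using (_⊎_)
open import Data.Unit using (⊤)
open import Data.Empty using (⊥)
open import Relation.Nullary using (¬_; Dec; yes; no)
open import Relation.Binary.PropositionalEquality using (_≡_)
open import Axiom.ExcludedMiddle using (ExcludedMiddle)
open import Function.Bundles using (_⇔_)

-- LTL in negation normal form over a set of atomic propositions Ap

infixr 6 _∧ₗ_
infixr 5 _∨ₗ_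
infixr 7 _U_ _W_ _M_ _R_

data LTL (Ap : Set) : Set where
  tt ff           : LTL Ap
  atom natom      : Ap → LTL Ap
  _∧ₗ_ _∨ₗ_       : LTL Ap → LTL Ap → LTL Ap
  X F G           : LTL Ap → LTL Ap
  _U_ _W_ _M_ _R_ : LTL Ap → LTL Ap → LTL Ap

-- letters ν ∈ 2^Ap (ν a = true iff a ∈ ν), infinite words, suffixes
Letter : Set → Set
Letter Ap = Ap → Bool

Word : Set → Set
Word Ap = ℕ → Letter Ap

suffix : {Ap : Set} → Word Ap → ℕ → Word Ap
suffix w k i = w (k + i)

infix 4 _⊨_
_⊨_ : {Ap : Set} → Word Ap → LTL Ap → Set
w ⊨ tt = ⊤
w ⊨ ff = ⊥
w ⊨ atom a = w 0 a ≡ true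
w ⊨ natom a = w 0 a ≡ false
w ⊨ (φ ∧ₗ ψ) = (w ⊨ φ) × (w ⊨ ψ)
w ⊨ (φ ∨ₗ ψ) = (w ⊨ φ) ⊎ (w ⊨ ψ)
w ⊨ X φ = suffix w 1 ⊨ φ
w ⊨ F φ = ∃ λ k → suffix w k ⊨ φ
w ⊨ G φ = ∀ k → suffix w k ⊨ φ
w ⊨ (φ U ψ) = ∃ λ k → (suffix w k ⊨ ψ) × (∀ j → j < k → suffix w j ⊨ φ)
w ⊨ (φ W ψ) = (∀ k → suffix w k ⊨ φ)
            ⊎ (∃ λ k → (suffix w k ⊨ ψ) × (∀ j → j < k → suffix w j ⊨ φ))
w ⊨ (φ M ψ) = ∃ λ k → (suffix w k ⊨ φ) × (∀ j → j ≤ k → suffix w j ⊨ ψ)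
w ⊨ (φ R ψ) = (∀ k → suffix w k ⊨ ψ)
            ⊎ (∃ λ k → (suffix w k ⊨ φ) × (∀ j → j ≤ k → suffix w j ⊨ ψ))

L : {Ap : Set} → LTL Ap → Word Ap → Set
L φ w = w ⊨ φ

data IsMu {Ap : Set} : LTL Ap → Set where
  tt    : IsMu tt
  ff    : IsMu ff
  atom  : ∀ a → IsMu (atom a)
  natom : ∀ a → IsMu (natom a)
  and   : ∀ {φ ψ} → IsMu φ → IsMu ψ → IsMu (φ ∧ₗ ψ)
  or    : ∀ {φ ψ} → IsMu φ → IsMu ψ → IsMu (φ ∨ₗ ψ)
  next  : ∀ {φ} → IsMu φ → IsMu (X φ)
  ev    : ∀ {φ} → IsMu φ → IsMu (F φ)
  until : ∀ {φ ψ} → IsMu φ → IsMu ψ → IsMu (φ U ψ)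
  mrel  : ∀ {φ ψ} → IsMu φ → IsMu ψ → IsMu (φ M ψ)

data IsNu {Ap : Set} : LTL Ap → Set where
  tt    : IsNu tt
  ff    : IsNu ff
  atom  : ∀ a → IsNu (atom a)
  natom : ∀ a → IsNu (natom a)
  and   : ∀ {φ ψ} → IsNu φ → IsNu ψ → IsNu (φ ∧ₗ ψ)
  or    : ∀ {φ ψ} → IsNu φ → IsNu ψ → IsNu (φ ∨ₗ ψ)
  next  : ∀ {φ} → IsNu φ → IsNu (X φ)
  alw   : ∀ {φ} → IsNu φ → IsNu (G φ)
  wuntil : ∀ {φ ψ} → IsNu φ → IsNu ψ → IsNu (φ W ψ)
  rel   : ∀ {φ ψ} → IsNu φ → IsNu ψ → IsNu (φ R ψ)

-- Propositional equivalence ≡P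
-- Every maximal proper subformula ψ is treated as a propositional
-- variable x_ψ; an assignment gives a truth value to every formula
-- (only the values on maximal proper subformulas are ever consulted).
-- tt / ff are the propositional constants.

peval : {Ap : Set} → (LTL Ap → Bool) → LTL Ap → Bool
peval σ tt = true
peval σ ff = false
peval σ (φ ∧ₗ ψ) = peval σ φ B.∧ peval σ ψ
peval σ (φ ∨ₗ ψ) = peval σ φ B.∨ peval σ ψ
peval σ φ = σ φ

infix 4 _≡P_
_≡P_ : {Ap : Set} → LTL Ap → LTL Ap → Set
φ ≡P ψ = ∀ σ → peval σ φ ≡ peval σ ψ

-- The "after function" af (on representatives; it respects ≡P)

af : {Ap : Set} → LTL Ap → Letter Ap → LTL Ap
af tt ν = tt
af ff ν = ff
af (atom a) ν = if ν a then tt else ff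
af (natom a) ν = if ν a then ff else tt
af (φ ∧ₗ ψ) ν = af φ ν ∧ₗ af ψ ν
af (φ ∨ₗ ψ) ν = af φ ν ∨ₗ af ψ ν
af (X φ) ν = φ
af (F φ) ν = af φ ν ∨ₗ F φ
af (G φ) ν = af φ ν ∧ₗ G φ
af (φ U ψ) ν = af ψ ν ∨ₗ (af φ ν ∧ₗ (φ U ψ))
af (φ W ψ) ν = af ψ ν ∨ₗ (af φ ν ∧ₗ (φ W ψ))
af (φ M ψ) ν = af ψ ν ∧ₗ (af φ ν ∨ₗ (φ M ψ))
af (φ R ψ) ν = af ψ ν ∧ₗ (af φ ν ∨ₗ (φ R ψ))

afw : {Ap : Set} → LTL Ap → List (Letter Ap) → LTL Ap
afw φ [] = φ
afw φ (ν ∷ u) = afw (af φ ν) u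

-- Reach(φ) as a predicate on (representatives of) ≡P-classes
Reach : {Ap : Set} → LTL Ap → LTL Ap → Set
Reach φ ψ = ∃ λ u → afw φ u ≡P ψ

-- af_{Fφ} and af_{Gφ}; the test "ψ ≡P tt" is decided using a
-- supplied excluded-middle oracle (≡P is decidable classically).
afF : {Ap : Set} → ExcludedMiddle 0ℓ → LTL Ap → LTL Ap → Letter Ap → LTL Ap
afF lem φ ψ ν with lem {ψ ≡P tt}
... | yes _ = F φ
... | no  _ = af ψ ν

afG : {Ap : Set} → ExcludedMiddle 0ℓ → LTL Ap → LTL Ap → Letter Ap → LTL Ap
afG lem φ ψ ν with lem {ψ ≡P ff}
... | yes _ = G φ
... | no  _ = af ψ ν

-- Deterministic automata whose states are ≡P-classes (represented by
-- formulas), with Büchi / coBüchi acceptance on a single class.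

record DetAut (Ap : Set) : Set₁ where
  constructor mkAut
  field
    States  : LTL Ap → Set
    δ       : LTL Ap → Letter Ap → LTL Ap
    initial : LTL Ap

open DetAut public

run : {Ap : Set} → DetAut Ap → Word Ap → ℕ → LTL Ap
run A w zero = initial A
run A w (suc k) = δ A (run A w k) (w k)

BuchiAccepts : {Ap : Set} → DetAut Ap → LTL Ap → Word Ap → Set
BuchiAccepts A s w = ∀ m → ∃ λ k → m ≤ k × (run A w k ≡P s)

CoBuchiAccepts : {Ap : Set} → DetAut Ap → LTL Ap → Word Ap → Set
CoBuchiAccepts A s w = ∃ λ m → ∀ k → m ≤ k → ¬ (run A w k ≡P s)

Recognizes : {Ap : Set} → (Word Ap → Set) → (Word Ap → Set) → Set
Recognizes Acc Lang = ∀ w → Lang w ⇔ Acc w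

A-mu : {Ap : Set} → LTL Ap → DetAut Ap
A-mu φ = mkAut (Reach φ) af φ

A-GFmu : {Ap : Set} → ExcludedMiddle 0ℓ → LTL Ap → DetAut Ap
A-GFmu lem φ = mkAut (Reach (F φ)) (afF lem φ) (F φ)

A-nu : {Ap : Set} → LTL Ap → DetAut Ap
A-nu φ = mkAut (Reach φ) af φ

A-FGnu : {Ap : Set} → ExcludedMiddle 0ℓ → LTL Ap → DetAut Ap
A-FGnu lem φ = mkAut (Reach (G φ)) (afG lem φ) (G φ)

-- The after-function af rewrites an obligation φ on a word w into the
-- obligation af(φ, w₀) on the suffix w₁ w₂ …, so the run of af along w
-- always denotes exactly what remains to be checked.  Hence a run that
-- reaches [tt]_P witnesses w ⊨ φ, and a run that reaches [ff]_P
-- refutes it; both classes are absorbing.  Conversely, a least-fixpoint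
-- formula that holds is discharged after finitely many letters (the run
-- reaches tt), and a greatest-fixpoint formula that fails is refuted
-- after finitely many letters (the run reaches ff).  For GF φ the
-- automaton restarts from F φ after each visit of tt; F φ propositionally
-- implies every state, so the run dominates the af-run of F φ started at
-- any position and reaches tt whenever that one does, while between two
-- visits of tt it is a plain af-run, which gives soundness.  FG φ is dual.

module Submission where

open import Defs
open import Level using (0ℓ)
open import Data.Nat using (ℕ)
open import Data.Fin using (Fin)
open import Data.Product using (_×_)
open import Axiom.ExcludedMiddle using (ExcludedMiddle)

open import Axiom.DoubleNegationElimination using (em⇒dne)
open import Data.Bool using (Bool; T; if_then_else_)
import Data.Bool as Bool
open import Data.Bool.Properties using (∧-zeroʳ; ∨-zeroʳ; T-≡; T-∧; T-∨; ¬-not)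
open import Data.Empty using (⊥-elim)
open import Data.Nat using (zero; suc; _+_; _≤_; _<_; _≤′_; ≤′-refl; ≤′-step; z≤n; s≤s)
open import Data.Nat.Properties
  using ( +-assoc; +-suc; +-identityʳ; m≤m+n; m≤n+m; n≤1+n; n<1+n; m<n⇒m<1+n; m≤n⇒m≤1+n
        ; ≤⇒≤′; m≤n⇒∃[o]m+o≡n)
open import Data.Product using (∃-syntax; _,_; proj₂)
open import Data.Product.Function.NonDependent.Propositional using (_×-⇔_)
open import Data.Sum using (inj₁; inj₂)
open import Data.Sum.Function.Propositional using (_⊎-⇔_)
open import Function using (_∘_; id)
open import Function.Bundles using (_⇔_; mk⇔; Equivalence)
open import Function.Construct.Composition using (_⇔-∘_)
open import Relation.Nullary using (¬_; yes; no)
open import Relation.Nullary.Decidable using (isYes; toWitness; fromWitness)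
open import Relation.Binary.PropositionalEquality
  using (_≡_; refl; sym; trans; cong; cong₂; subst; _≗_; module ≡-Reasoning)

open Equivalence using (to; from)

private
  variable
    Ap : Set
    x y φ ψ : LTL Ap
    v v′ w : Word Ap
    ν : Letter Ap
    k m n : ℕ

peval-af : ∀ (σ : LTL Ap → Bool) ν x → peval σ (af x ν) ≡ peval (λ χ → peval σ (af χ ν)) x
peval-af σ ν tt = refl
peval-af σ ν ff = refl
peval-af σ ν (atom a) = refl
peval-af σ ν (natom a) = refl
peval-af σ ν (x ∧ₗ y) = cong₂ Bool._∧_ (peval-af σ ν x) (peval-af σ ν y)
peval-af σ ν (x ∨ₗ y) = cong₂ Bool._∨_ (peval-af σ ν x) (peval-af σ ν y)
peval-af σ ν (X x) = refl
peval-af σ ν (F x) = refl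
peval-af σ ν (G x) = refl
peval-af σ ν (x U y) = refl
peval-af σ ν (x W y) = refl
peval-af σ ν (x M y) = refl
peval-af σ ν (x R y) = refl

af-cong : ∀ (x y : LTL Ap) → x ≡P y → af x ν ≡P af y ν
af-cong {ν = ν} x y e σ =
  trans (peval-af σ ν x) (trans (e _) (sym (peval-af σ ν y)))

∧-tt : ∀ (x y : LTL Ap) → x ≡P tt → y ≡P tt → x ∧ₗ y ≡P tt
∧-tt _ _ p q σ = cong₂ Bool._∧_ (p σ) (q σ)

∨-ttˡ : ∀ (x y : LTL Ap) → x ≡P tt → x ∨ₗ y ≡P tt
∨-ttˡ _ _ p σ = cong (Bool._∨ _) (p σ)

∨-ttʳ : ∀ (x y : LTL Ap) → y ≡P tt → x ∨ₗ y ≡P tt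
∨-ttʳ x _ p σ = trans (cong (peval σ x Bool.∨_) (p σ)) (∨-zeroʳ _)

∨-ff : ∀ (x y : LTL Ap) → x ≡P ff → y ≡P ff → x ∨ₗ y ≡P ff
∨-ff _ _ p q σ = cong₂ Bool._∨_ (p σ) (q σ)

∧-ffˡ : ∀ (x y : LTL Ap) → x ≡P ff → x ∧ₗ y ≡P ff
∧-ffˡ _ _ p σ = cong (Bool._∧ _) (p σ)

∧-ffʳ : ∀ (x y : LTL Ap) → y ≡P ff → x ∧ₗ y ≡P ff
∧-ffʳ x _ p σ = trans (cong (peval σ x Bool.∧_) (p σ)) (∧-zeroʳ _)

-- A record rather than a function type, so that its endpoints can be inferred.
infix 4 _⇒P_
record _⇒P_ {Ap : Set} (x y : LTL Ap) : Set where
  constructor mk⇒P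
  field implies : ∀ σ → T (peval σ x) → T (peval σ y)

⇒P-refl : x ⇒P x
⇒P-refl = mk⇒P λ _ → id

⇒P-trans : x ⇒P y → y ⇒P ψ → x ⇒P ψ
⇒P-trans (mk⇒P p) (mk⇒P q) = mk⇒P λ σ → q σ ∘ p σ

⇒P-tt : x ⇒P y → x ≡P tt → y ≡P tt
⇒P-tt (mk⇒P p) t σ = to T-≡ (p σ (from T-≡ (t σ)))

⇒P-ff : x ⇒P y → y ≡P ff → x ≡P ff
⇒P-ff (mk⇒P p) f σ = ¬-not (subst T (f σ) ∘ p σ ∘ from T-≡)

af-mono : x ⇒P y → af x ν ⇒P af y ν
af-mono {x = x} {y = y} {ν = ν} (mk⇒P p) = mk⇒P λ σ →
  subst T (sym (peval-af σ ν y)) ∘ p _ ∘ subst T (peval-af σ ν x)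

afRun : LTL Ap → Word Ap → ℕ → LTL Ap
afRun x = run (A-mu x)

afRun-shift : ∀ (x : LTL Ap) v n → afRun x v (suc n) ≡ afRun (af x (v 0)) (suffix v 1) n
afRun-shift x v zero = refl
afRun-shift x v (suc n) = cong (λ z → af z (v (suc n))) (afRun-shift x v n)

afRun-∧ : ∀ (x y : LTL Ap) v n → afRun (x ∧ₗ y) v n ≡ afRun x v n ∧ₗ afRun y v n
afRun-∧ x y v zero = refl
afRun-∧ x y v (suc n) = cong (λ z → af z (v n)) (afRun-∧ x y v n)

afRun-∨ : ∀ (x y : LTL Ap) v n → afRun (x ∨ₗ y) v n ≡ afRun x v n ∨ₗ afRun y v n
afRun-∨ x y v zero = refl
afRun-∨ x y v (suc n) = cong (λ z → af z (v n)) (afRun-∨ x y v n)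

afRun-mono : x ⇒P y → ∀ n → afRun x v n ⇒P afRun y v n
afRun-mono p zero = p
afRun-mono p (suc n) = af-mono (afRun-mono p n)

run-follows-af : (A : DetAut Ap) (w : Word Ap) (m n : ℕ) →
  (∀ i → i < n → δ A (run A w (m + i)) (w (m + i)) ≡ af (run A w (m + i)) (w (m + i))) →
  run A w (m + n) ≡ afRun (run A w m) (suffix w m) n
run-follows-af A w m zero _ = cong (run A w) (+-identityʳ m)
run-follows-af A w m (suc n) agrees = begin
  run A w (m + suc n)                              ≡⟨ cong (run A w) (+-suc m n) ⟩
  δ A (run A w (m + n)) (w (m + n))                ≡⟨ agrees n (n<1+n n) ⟩
  af (run A w (m + n)) (w (m + n))                 ≡⟨ cong (λ z → af z (w (m + n))) ih ⟩
  afRun (run A w m) (suffix w m) (suc n)           ∎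
  where
  open ≡-Reasoning
  ih = run-follows-af A w m n (λ i i<n → agrees i (m<n⇒m<1+n i<n))

module _ (P : ℕ → Set) where

  propagate-up : (∀ k → P k → P (suc k)) → m ≤ n → P m → P n
  propagate-up step = go ∘ ≤⇒≤′
    where
    go : m ≤′ n → P m → P n
    go ≤′-refl p = p
    go (≤′-step le) p = step _ (go le p)

  propagate-down : (∀ k → P (suc k) → P k) → m ≤ n → P n → P m
  propagate-down step = go ∘ ≤⇒≤′
    where
    go : m ≤′ n → P n → P m
    go ≤′-refl p = p
    go (≤′-step le) p = go le (step _ p)

Reaches : LTL Ap → LTL Ap → Word Ap → Set
Reaches c x v = ∃[ n ] afRun x v n ≡P c

data Absorbing {Ap : Set} : LTL Ap → Set where
  instance
    tt-absorbing : Absorbing tt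
    ff-absorbing : Absorbing ff

af-absorbing : {c : LTL Ap} → Absorbing c → af c ν ≡ c
af-absorbing tt-absorbing = refl
af-absorbing ff-absorbing = refl

module _ {c : LTL Ap} {{c-absorbing : Absorbing c}} where

  afRun-persist : m ≤ n → afRun x v m ≡P c → afRun x v n ≡P c
  afRun-persist {x = x} {v = v} = propagate-up (λ k → afRun x v k ≡P c)
    λ k e → subst (af (afRun x v k) (v k) ≡P_) (af-absorbing c-absorbing)
                  (af-cong (afRun x v k) c e)

  reaches-af : Reaches c (af x (v 0)) (suffix v 1) → Reaches c x v
  reaches-af {x = x} {v = v} (n , e) = suc n , subst (_≡P c) (sym (afRun-shift x v n)) e

  reaches-af⁻ : Reaches c x v → Reaches c (af x (v 0)) (suffix v 1)
  reaches-af⁻ {x = x} {v = v} (n , e) =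
    n , subst (_≡P c) (afRun-shift x v n) (afRun-persist (n≤1+n n) e)

  reaches-together : Reaches c x v → Reaches c y v → ∃[ n ] afRun x v n ≡P c × afRun y v n ≡P c
  reaches-together (m , p) (n , q) =
    m + n , afRun-persist (m≤m+n m n) p , afRun-persist (m≤n+m n m) q

reaches-tt-∧ : Reaches tt x v → Reaches tt y v → Reaches tt (x ∧ₗ y) v
reaches-tt-∧ {x = x} {v = v} {y = y} rx ry with reaches-together rx ry
... | n , p , q = n , subst (_≡P tt) (sym (afRun-∧ x y v n))
    (∧-tt (afRun x v n) (afRun y v n) p q)

reaches-tt-∨ˡ : Reaches tt x v → Reaches tt (x ∨ₗ y) v
reaches-tt-∨ˡ {x = x} {v = v} {y = y} (n , p) =
  n , subst (_≡P tt) (sym (afRun-∨ x y v n))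
    (∨-ttˡ (afRun x v n) (afRun y v n) p)

reaches-tt-∨ʳ : Reaches tt y v → Reaches tt (x ∨ₗ y) v
reaches-tt-∨ʳ {y = y} {v = v} {x = x} (n , p) =
  n , subst (_≡P tt) (sym (afRun-∨ x y v n))
    (∨-ttʳ (afRun x v n) (afRun y v n) p)

reaches-ff-∨ : Reaches ff x v → Reaches ff y v → Reaches ff (x ∨ₗ y) v
reaches-ff-∨ {x = x} {v = v} {y = y} rx ry with reaches-together rx ry
... | n , p , q = n , subst (_≡P ff) (sym (afRun-∨ x y v n))
    (∨-ff (afRun x v n) (afRun y v n) p q)

reaches-ff-∧ˡ : Reaches ff x v → Reaches ff (x ∧ₗ y) v
reaches-ff-∧ˡ {x = x} {v = v} {y = y} (n , p) =
  n , subst (_≡P ff) (sym (afRun-∧ x y v n))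
    (∧-ffˡ (afRun x v n) (afRun y v n) p)

reaches-ff-∧ʳ : Reaches ff y v → Reaches ff (x ∧ₗ y) v
reaches-ff-∧ʳ {y = y} {v = v} {x = x} (n , p) =
  n , subst (_≡P ff) (sym (afRun-∧ x y v n))
    (∧-ffʳ (afRun x v n) (afRun y v n) p)

⊨-resp-≗ : ∀ φ → v ≗ v′ → v ⊨ φ → v′ ⊨ φ
⊨-resp-≗ tt e s = s
⊨-resp-≗ (atom a) e s = trans (cong (λ ν → ν a) (sym (e 0))) s
⊨-resp-≗ (natom a) e s = trans (cong (λ ν → ν a) (sym (e 0))) s
⊨-resp-≗ (φ ∧ₗ ψ) e (s , t) = ⊨-resp-≗ φ e s , ⊨-resp-≗ ψ e t
⊨-resp-≗ (φ ∨ₗ ψ) e (inj₁ s) = inj₁ (⊨-resp-≗ φ e s)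
⊨-resp-≗ (φ ∨ₗ ψ) e (inj₂ s) = inj₂ (⊨-resp-≗ ψ e s)
⊨-resp-≗ (X φ) e s = ⊨-resp-≗ φ (e ∘ suc) s
⊨-resp-≗ (F φ) e (k , s) = k , ⊨-resp-≗ φ (e ∘ (k +_)) s
⊨-resp-≗ (G φ) e g k = ⊨-resp-≗ φ (e ∘ (k +_)) (g k)
⊨-resp-≗ (φ U ψ) e (k , s , h) =
  k , ⊨-resp-≗ ψ (e ∘ (k +_)) s , λ j j<k → ⊨-resp-≗ φ (e ∘ (j +_)) (h j j<k)
⊨-resp-≗ (φ W ψ) e (inj₁ g) = inj₁ λ k → ⊨-resp-≗ φ (e ∘ (k +_)) (g k)
⊨-resp-≗ (φ W ψ) e (inj₂ (k , s , h)) =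
  inj₂ (k , ⊨-resp-≗ ψ (e ∘ (k +_)) s , λ j j<k → ⊨-resp-≗ φ (e ∘ (j +_)) (h j j<k))
⊨-resp-≗ (φ M ψ) e (k , s , h) =
  k , ⊨-resp-≗ φ (e ∘ (k +_)) s , λ j j≤k → ⊨-resp-≗ ψ (e ∘ (j +_)) (h j j≤k)
⊨-resp-≗ (φ R ψ) e (inj₁ g) = inj₁ λ k → ⊨-resp-≗ ψ (e ∘ (k +_)) (g k)
⊨-resp-≗ (φ R ψ) e (inj₂ (k , s , h)) =
  inj₂ (k , ⊨-resp-≗ φ (e ∘ (k +_)) s , λ j j≤k → ⊨-resp-≗ ψ (e ∘ (j +_)) (h j j≤k))

infixr 5 _◃_
_◃_ : Letter Ap → Word Ap → Word Ap
(ν ◃ v) zero = ν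
(ν ◃ v) (suc i) = v i

⊨⇒⊨-af : ∀ φ → ν ◃ v ⊨ φ → v ⊨ af φ ν
⊨⇒⊨-af tt s = s
⊨⇒⊨-af (atom a) s rewrite s = _
⊨⇒⊨-af (natom a) s rewrite s = _
⊨⇒⊨-af (φ ∧ₗ ψ) (s , t) = ⊨⇒⊨-af φ s , ⊨⇒⊨-af ψ t
⊨⇒⊨-af (φ ∨ₗ ψ) (inj₁ s) = inj₁ (⊨⇒⊨-af φ s)
⊨⇒⊨-af (φ ∨ₗ ψ) (inj₂ s) = inj₂ (⊨⇒⊨-af ψ s)
⊨⇒⊨-af (X φ) s = s
⊨⇒⊨-af (F φ) (zero , s) = inj₁ (⊨⇒⊨-af φ s)
⊨⇒⊨-af (F φ) (suc k , s) = inj₂ (k , s)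
⊨⇒⊨-af (G φ) g = ⊨⇒⊨-af φ (g 0) , g ∘ suc
⊨⇒⊨-af (φ U ψ) (zero , s , _) = inj₁ (⊨⇒⊨-af ψ s)
⊨⇒⊨-af (φ U ψ) (suc k , s , h) =
  inj₂ (⊨⇒⊨-af φ (h 0 (s≤s z≤n)) , k , s , λ j j<k → h (suc j) (s≤s j<k))
⊨⇒⊨-af (φ W ψ) (inj₁ g) = inj₂ (⊨⇒⊨-af φ (g 0) , inj₁ (g ∘ suc))
⊨⇒⊨-af (φ W ψ) (inj₂ (zero , s , _)) = inj₁ (⊨⇒⊨-af ψ s)
⊨⇒⊨-af (φ W ψ) (inj₂ (suc k , s , h)) =
  inj₂ (⊨⇒⊨-af φ (h 0 (s≤s z≤n)) , inj₂ (k , s , λ j j<k → h (suc j) (s≤s j<k)))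
⊨⇒⊨-af (φ M ψ) (zero , s , h) = ⊨⇒⊨-af ψ (h 0 z≤n) , inj₁ (⊨⇒⊨-af φ s)
⊨⇒⊨-af (φ M ψ) (suc k , s , h) =
  ⊨⇒⊨-af ψ (h 0 z≤n) , inj₂ (k , s , λ j j≤k → h (suc j) (s≤s j≤k))
⊨⇒⊨-af (φ R ψ) (inj₁ g) = ⊨⇒⊨-af ψ (g 0) , inj₂ (inj₁ (g ∘ suc))
⊨⇒⊨-af (φ R ψ) (inj₂ (zero , s , h)) = ⊨⇒⊨-af ψ (h 0 z≤n) , inj₁ (⊨⇒⊨-af φ s)
⊨⇒⊨-af (φ R ψ) (inj₂ (suc k , s , h)) =
  ⊨⇒⊨-af ψ (h 0 z≤n) , inj₂ (inj₂ (k , s , λ j j≤k → h (suc j) (s≤s j≤k)))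

⊨-af⇒⊨ : ∀ φ → v ⊨ af φ ν → ν ◃ v ⊨ φ
⊨-af⇒⊨ tt s = s
⊨-af⇒⊨ {ν = ν} (atom a) s with ν a
... | Bool.true = refl
⊨-af⇒⊨ {ν = ν} (natom a) s with ν a
... | Bool.false = refl
⊨-af⇒⊨ (φ ∧ₗ ψ) (s , t) = ⊨-af⇒⊨ φ s , ⊨-af⇒⊨ ψ t
⊨-af⇒⊨ (φ ∨ₗ ψ) (inj₁ s) = inj₁ (⊨-af⇒⊨ φ s)
⊨-af⇒⊨ (φ ∨ₗ ψ) (inj₂ s) = inj₂ (⊨-af⇒⊨ ψ s)
⊨-af⇒⊨ (X φ) s = s
⊨-af⇒⊨ (F φ) (inj₁ s) = 0 , ⊨-af⇒⊨ φ s
⊨-af⇒⊨ (F φ) (inj₂ (k , s)) = suc k , s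
⊨-af⇒⊨ (G φ) (s , g) = λ { zero → ⊨-af⇒⊨ φ s ; (suc k) → g k }
⊨-af⇒⊨ (φ U ψ) (inj₁ s) = 0 , ⊨-af⇒⊨ ψ s , λ _ ()
⊨-af⇒⊨ (φ U ψ) (inj₂ (s , k , t , h)) =
  suc k , t , λ { zero _ → ⊨-af⇒⊨ φ s ; (suc j) (s≤s j<k) → h j j<k }
⊨-af⇒⊨ (φ W ψ) (inj₁ s) = inj₂ (0 , ⊨-af⇒⊨ ψ s , λ _ ())
⊨-af⇒⊨ (φ W ψ) (inj₂ (s , inj₁ g)) = inj₁ λ { zero → ⊨-af⇒⊨ φ s ; (suc k) → g k }
⊨-af⇒⊨ (φ W ψ) (inj₂ (s , inj₂ (k , t , h))) =
  inj₂ (suc k , t , λ { zero _ → ⊨-af⇒⊨ φ s ; (suc j) (s≤s j<k) → h j j<k })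
⊨-af⇒⊨ (φ M ψ) (s , inj₁ t) = 0 , ⊨-af⇒⊨ φ t , λ { zero z≤n → ⊨-af⇒⊨ ψ s }
⊨-af⇒⊨ (φ M ψ) (s , inj₂ (k , t , h)) =
  suc k , t , λ { zero _ → ⊨-af⇒⊨ ψ s ; (suc j) (s≤s j≤k) → h j j≤k }
⊨-af⇒⊨ (φ R ψ) (s , inj₁ t) = inj₂ (0 , ⊨-af⇒⊨ φ t , λ { zero z≤n → ⊨-af⇒⊨ ψ s })
⊨-af⇒⊨ (φ R ψ) (s , inj₂ (inj₁ g)) = inj₁ λ { zero → ⊨-af⇒⊨ ψ s ; (suc k) → g k }
⊨-af⇒⊨ (φ R ψ) (s , inj₂ (inj₂ (k , t , h))) =
  inj₂ (suc k , t , λ { zero _ → ⊨-af⇒⊨ ψ s ; (suc j) (s≤s j≤k) → h j j≤k })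

suffix-◃ : ∀ (w : Word Ap) k → suffix w k ≗ (w k ◃ suffix w (suc k))
suffix-◃ w k zero = cong w (+-identityʳ k)
suffix-◃ w k (suc i) = cong w (+-suc k i)

⊨-suffix-af : ∀ (w : Word Ap) k φ → suffix w k ⊨ φ ⇔ suffix w (suc k) ⊨ af φ (w k)
⊨-suffix-af w k φ = mk⇔
  (⊨⇒⊨-af φ ∘ ⊨-resp-≗ φ (suffix-◃ w k))
  (⊨-resp-≗ φ (sym ∘ suffix-◃ w k) ∘ ⊨-af⇒⊨ φ)

⊨-afRun : ∀ (φ : LTL Ap) w k → w ⊨ φ → suffix w k ⊨ afRun φ w k
⊨-afRun φ w k = propagate-up (λ i → suffix w i ⊨ afRun φ w i)
  (λ i → to (⊨-suffix-af w i (afRun φ w i))) (z≤n {k})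

afRun-⊨ : ∀ (φ : LTL Ap) w k → suffix w k ⊨ afRun φ w k → w ⊨ φ
afRun-⊨ φ w k = propagate-down (λ i → suffix w i ⊨ afRun φ w i)
  (λ i → from (⊨-suffix-af w i (afRun φ w i))) (z≤n {k})

suffix-reassoc : ∀ (w : Word Ap) m d j → suffix (suffix w m) (d + j) ≗ suffix (suffix w (m + d)) j
suffix-reassoc w m d j i = cong w (begin
  m + (d + j + i)    ≡⟨ cong (m +_) (+-assoc d j i) ⟩
  m + (d + (j + i))  ≡⟨ sym (+-assoc m d (j + i)) ⟩
  m + d + (j + i)    ∎)
  where open ≡-Reasoning

G-later : ∀ (w : Word Ap) φ → m ≤ n → suffix w m ⊨ G φ → suffix w n ⊨ G φ
G-later {m = m} w φ le g with m≤n⇒∃[o]m+o≡n le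
... | d , refl = λ j → ⊨-resp-≗ φ (suffix-reassoc w m d j) (g (d + j))

F-earlier : ∀ (w : Word Ap) φ → m ≤ n → suffix w n ⊨ F φ → suffix w m ⊨ F φ
F-earlier {m = m} w φ le (j , s) with m≤n⇒∃[o]m+o≡n le
... | d , refl = d + j , ⊨-resp-≗ φ (sym ∘ suffix-reassoc w m d j) s

-- Least fixpoints are discharged in finitely many steps

reaches-tt-U : (∀ {v} → v ⊨ φ → Reaches tt φ v) → (∀ {v} → v ⊨ ψ → Reaches tt ψ v) →
  ∀ k → suffix v k ⊨ ψ → (∀ j → j < k → suffix v j ⊨ φ) → Reaches tt (φ U ψ) v
reaches-tt-U rφ rψ zero s _ = reaches-af (reaches-tt-∨ˡ (reaches-af⁻ (rψ s)))
reaches-tt-U rφ rψ (suc k) s h = reaches-af (reaches-tt-∨ʳ (reaches-tt-∧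
  (reaches-af⁻ (rφ (h 0 (s≤s z≤n))))
  (reaches-tt-U rφ rψ k s λ j j<k → h (suc j) (s≤s j<k))))

reaches-tt-M : (∀ {v} → v ⊨ φ → Reaches tt φ v) → (∀ {v} → v ⊨ ψ → Reaches tt ψ v) →
  ∀ k → suffix v k ⊨ φ → (∀ j → j ≤ k → suffix v j ⊨ ψ) → Reaches tt (φ M ψ) v
reaches-tt-M rφ rψ zero s h = reaches-af (reaches-tt-∧
  (reaches-af⁻ (rψ (h 0 z≤n)))
  (reaches-tt-∨ˡ (reaches-af⁻ (rφ s))))
reaches-tt-M rφ rψ (suc k) s h = reaches-af (reaches-tt-∧
  (reaches-af⁻ (rψ (h 0 z≤n)))
  (reaches-tt-∨ʳ (reaches-tt-M rφ rψ k s λ j j≤k → h (suc j) (s≤s j≤k))))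

reaches-tt-F : ∀ j → Reaches tt φ (suffix v j) → Reaches tt (F φ) v
reaches-tt-F zero r = reaches-af (reaches-tt-∨ˡ (reaches-af⁻ r))
reaches-tt-F (suc j) r = reaches-af (reaches-tt-∨ʳ (reaches-tt-F j r))

reaches-tt : IsMu φ → v ⊨ φ → Reaches tt φ v
reaches-tt tt _ = 0 , λ _ → refl
reaches-tt (atom a) s = 1 , λ σ → cong (λ b → peval σ (if b then tt else ff)) s
reaches-tt (natom a) s = 1 , λ σ → cong (λ b → peval σ (if b then ff else tt)) s
reaches-tt (and μφ μψ) (s , t) = reaches-tt-∧ (reaches-tt μφ s) (reaches-tt μψ t)
reaches-tt (or μφ μψ) (inj₁ s) = reaches-tt-∨ˡ (reaches-tt μφ s)
reaches-tt (or μφ μψ) (inj₂ s) = reaches-tt-∨ʳ (reaches-tt μψ s)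
reaches-tt (next μφ) s = reaches-af (reaches-tt μφ s)
reaches-tt (ev μφ) (j , s) = reaches-tt-F j (reaches-tt μφ s)
reaches-tt (until μφ μψ) (k , s , h) = reaches-tt-U (reaches-tt μφ) (reaches-tt μψ) k s h
reaches-tt (mrel μφ μψ) (k , s , h) = reaches-tt-M (reaches-tt μφ) (reaches-tt μψ) k s h

module _ (lem : ExcludedMiddle 0ℓ) where

  -- Valuing each proper subformula by its truth on v turns propositional
  -- facts about a state into semantic facts about v.
  truth : Word Ap → LTL Ap → Bool
  truth v χ = isYes (lem {v ⊨ χ})

  peval-truth : ∀ x → T (peval (truth v) x) ⇔ v ⊨ x
  peval-truth tt = mk⇔ _ _
  peval-truth ff = mk⇔ id id
  peval-truth (x ∧ₗ y) = (peval-truth x ×-⇔ peval-truth y) ⇔-∘ T-∧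
  peval-truth (x ∨ₗ y) = (peval-truth x ⊎-⇔ peval-truth y) ⇔-∘ T-∨
  peval-truth (atom a) = mk⇔ toWitness fromWitness
  peval-truth (natom a) = mk⇔ toWitness fromWitness
  peval-truth (X x) = mk⇔ toWitness fromWitness
  peval-truth (F x) = mk⇔ toWitness fromWitness
  peval-truth (G x) = mk⇔ toWitness fromWitness
  peval-truth (x U y) = mk⇔ toWitness fromWitness
  peval-truth (x W y) = mk⇔ toWitness fromWitness
  peval-truth (x M y) = mk⇔ toWitness fromWitness
  peval-truth (x R y) = mk⇔ toWitness fromWitness

  ≡P-tt⇒⊨ : ∀ x → x ≡P tt → v ⊨ x
  ≡P-tt⇒⊨ {v = v} x t = to (peval-truth x) (from T-≡ (t (truth v)))

  ⊨⇒¬≡P-ff : ∀ x → v ⊨ x → ¬ x ≡P ff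
  ⊨⇒¬≡P-ff {v = v} x s f = subst T (f (truth v)) (from (peval-truth x) s)

  ¬∀⇒∃¬ : {P : ℕ → Set} → ¬ (∀ k → P k) → ∃[ k ] ¬ P k
  ¬∀⇒∃¬ ¬∀P = dne λ ¬∃ → ¬∀P λ k → dne λ ¬Pk → ¬∃ (k , ¬Pk)
    where dne = em⇒dne lem

  -- Greatest fixpoints are refuted in finitely many steps

  reaches-ff-W : (∀ {v} → ¬ v ⊨ φ → Reaches ff φ v) → (∀ {v} → ¬ v ⊨ ψ → Reaches ff ψ v) →
    ∀ k → ¬ suffix v k ⊨ φ → ¬ v ⊨ φ W ψ → Reaches ff (φ W ψ) v
  reaches-ff-W {φ = φ} {ψ = ψ} {v = v} rφ rψ k ¬φₖ ¬W =
    reaches-af (reaches-ff-∨ (reaches-af⁻ (rψ (¬W ∘ W-now))) (continue k ¬φₖ))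
    where
    W-now : v ⊨ ψ → v ⊨ φ W ψ
    W-now s = inj₂ (0 , s , λ _ ())
    W-later : v ⊨ φ → suffix v 1 ⊨ φ W ψ → v ⊨ φ W ψ
    W-later φ₀ s = from (⊨-suffix-af v 0 (φ W ψ)) (inj₂ (to (⊨-suffix-af v 0 φ) φ₀ , s))
    continue : ∀ k → ¬ suffix v k ⊨ φ → Reaches ff (af φ (v 0) ∧ₗ φ W ψ) (suffix v 1)
    continue k ¬φₖ with lem {v ⊨ φ}
    ... | no ¬φ = reaches-ff-∧ˡ (reaches-af⁻ (rφ ¬φ))
    continue zero ¬φ₀ | yes φ₀ = ⊥-elim (¬φ₀ φ₀)
    continue (suc k) ¬φₖ | yes φ₀ = reaches-ff-∧ʳ (reaches-ff-W rφ rψ k ¬φₖ (¬W ∘ W-later φ₀))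

  reaches-ff-R : (∀ {v} → ¬ v ⊨ φ → Reaches ff φ v) → (∀ {v} → ¬ v ⊨ ψ → Reaches ff ψ v) →
    ∀ k → ¬ suffix v k ⊨ ψ → ¬ v ⊨ φ R ψ → Reaches ff (φ R ψ) v
  reaches-ff-R {ψ = ψ} {v = v} rφ rψ k ¬ψₖ ¬R with lem {v ⊨ ψ}
  ... | no ¬ψ = reaches-af (reaches-ff-∧ˡ (reaches-af⁻ (rψ ¬ψ)))
  reaches-ff-R rφ rψ zero ¬ψₖ ¬R | yes ψ₀ = ⊥-elim (¬ψₖ ψ₀)
  reaches-ff-R {φ = φ} {ψ = ψ} {v = v} rφ rψ (suc k) ¬ψₖ ¬R | yes ψ₀ =
    reaches-af (reaches-ff-∧ʳ (reaches-ff-∨ φ-refuted (reaches-ff-R rφ rψ k ¬ψₖ ¬R′)))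
    where
    unfold = from (⊨-suffix-af v 0 (φ R ψ)) ∘ (to (⊨-suffix-af v 0 ψ) ψ₀ ,_)
    φ-refuted = reaches-af⁻ (rφ λ s → ¬R (unfold (inj₁ (to (⊨-suffix-af v 0 φ) s))))
    ¬R′ : ¬ suffix v 1 ⊨ φ R ψ
    ¬R′ = ¬R ∘ unfold ∘ inj₂

  reaches-ff-G : ∀ j → Reaches ff φ (suffix v j) → Reaches ff (G φ) v
  reaches-ff-G zero r = reaches-af (reaches-ff-∧ˡ (reaches-af⁻ r))
  reaches-ff-G (suc j) r = reaches-af (reaches-ff-∧ʳ (reaches-ff-G j r))

  reaches-ff : IsNu φ → ¬ v ⊨ φ → Reaches ff φ v
  reaches-ff tt ¬s = ⊥-elim (¬s _)
  reaches-ff ff _ = 0 , λ _ → refl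
  reaches-ff (atom a) ¬s = 1 , λ σ → cong (λ b → peval σ (if b then tt else ff)) (¬-not ¬s)
  reaches-ff (natom a) ¬s = 1 , λ σ → cong (λ b → peval σ (if b then ff else tt)) (¬-not ¬s)
  reaches-ff {v = v} (and {φ = φ} νφ νψ) ¬s with lem {v ⊨ φ}
  ... | no ¬φ = reaches-ff-∧ˡ (reaches-ff νφ ¬φ)
  ... | yes φ₀ = reaches-ff-∧ʳ (reaches-ff νψ λ ψ₀ → ¬s (φ₀ , ψ₀))
  reaches-ff (or νφ νψ) ¬s = reaches-ff-∨ (reaches-ff νφ (¬s ∘ inj₁)) (reaches-ff νψ (¬s ∘ inj₂))
  reaches-ff (next νφ) ¬s = reaches-af (reaches-ff νφ ¬s)
  reaches-ff (alw νφ) ¬s with ¬∀⇒∃¬ ¬s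
  ... | j , ¬φⱼ = reaches-ff-G j (reaches-ff νφ ¬φⱼ)
  reaches-ff (wuntil νφ νψ) ¬s with ¬∀⇒∃¬ (¬s ∘ inj₁)
  ... | k , ¬φₖ = reaches-ff-W (reaches-ff νφ) (reaches-ff νψ) k ¬φₖ ¬s
  reaches-ff (rel νφ νψ) ¬s with ¬∀⇒∃¬ (¬s ∘ inj₁)
  ... | k , ¬ψₖ = reaches-ff-R (reaches-ff νφ) (reaches-ff νψ) k ¬ψₖ ¬s

  A-mu-recognizes : IsMu φ → Recognizes (BuchiAccepts (A-mu φ) tt) (L φ)
  A-mu-recognizes {φ = φ} μφ w = mk⇔ accepts sound
    where
    accepts : w ⊨ φ → BuchiAccepts (A-mu φ) tt w
    accepts s m with reaches-tt μφ s
    ... | n , e = m + n , m≤m+n m n , afRun-persist (m≤n+m n m) e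
    sound : BuchiAccepts (A-mu φ) tt w → w ⊨ φ
    sound acc with acc 0
    ... | k , _ , e = afRun-⊨ φ w k (≡P-tt⇒⊨ (afRun φ w k) e)

  A-nu-recognizes : IsNu φ → Recognizes (CoBuchiAccepts (A-nu φ) ff) (L φ)
  A-nu-recognizes {φ = φ} νφ w = mk⇔ accepts sound
    where
    accepts : w ⊨ φ → CoBuchiAccepts (A-nu φ) ff w
    accepts s = 0 , λ k _ → ⊨⇒¬≡P-ff (afRun φ w k) (⊨-afRun φ w k s)
    sound : CoBuchiAccepts (A-nu φ) ff w → w ⊨ φ
    sound (m , h) with lem {w ⊨ φ}
    ... | yes s = s
    ... | no ¬s with reaches-ff νφ ¬s
    ...   | n , e = ⊥-elim (h (m + n) (m≤m+n m n) (afRun-persist (m≤n+m n m) e))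

  afF-tt : ∀ ψ → ψ ≡P tt → afF lem φ ψ ν ≡ F φ
  afF-tt ψ t with lem {ψ ≡P tt}
  ... | yes _ = refl
  ... | no ¬t = ⊥-elim (¬t t)

  afF-¬tt : ∀ ψ → ¬ ψ ≡P tt → afF lem φ ψ ν ≡ af ψ ν
  afF-¬tt ψ ¬t with lem {ψ ≡P tt}
  ... | yes t = ⊥-elim (¬t t)
  ... | no _ = refl

  F⇒P-afF : F φ ⇒P ψ → F φ ⇒P afF lem φ ψ ν
  F⇒P-afF {ψ = ψ} p with lem {ψ ≡P tt}
  ... | yes _ = ⇒P-refl
  ... | no _ = ⇒P-trans (mk⇒P λ _ → from T-∨ ∘ inj₂) (af-mono p)

  F⇒P-run-GF : ∀ k → F φ ⇒P run (A-GFmu lem φ) w k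
  F⇒P-run-GF zero = ⇒P-refl
  F⇒P-run-GF (suc k) = F⇒P-afF (F⇒P-run-GF k)

  afF-sound : ∀ (w : Word Ap) k ψ → suffix w (suc k) ⊨ afF lem φ ψ (w k) → suffix w k ⊨ ψ
  afF-sound w k ψ s with lem {ψ ≡P tt}
  ... | yes t = ≡P-tt⇒⊨ ψ t
  ... | no _ = from (⊨-suffix-af w k ψ) s

  A-GFmu-recognizes : IsMu φ → Recognizes (BuchiAccepts (A-GFmu lem φ) tt) (L (G (F φ)))
  A-GFmu-recognizes {φ = φ} μφ w = mk⇔ accepts sound
    where
    r = run (A-GFmu lem φ) w
    accepts : w ⊨ G (F φ) → BuchiAccepts (A-GFmu lem φ) tt w
    accepts gf m with reaches-tt (ev μφ) (gf m)
    ... | n , e with lem {∃[ i ] i < n × r (m + i) ≡P tt}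
    ...   | yes (i , _ , t) = m + i , m≤m+n m i , t
    ...   | no none = m + n , m≤m+n m n ,
      subst (_≡P tt) (sym no-restart) (⇒P-tt (afRun-mono (F⇒P-run-GF m) n) e)
      where
      no-restart : r (m + n) ≡ afRun (r m) (suffix w m) n
      no-restart = run-follows-af (A-GFmu lem φ) w m n
        λ i i<n → afF-¬tt (r (m + i)) λ t → none (i , i<n , t)
    sound : BuchiAccepts (A-GFmu lem φ) tt w → w ⊨ G (F φ)
    sound acc m with acc m
    ... | k , m≤k , t with acc (suc k)
    ...   | k′ , k<k′ , t′ = F-earlier w φ (m≤n⇒m≤1+n m≤k)
      (subst (suffix w (suc k) ⊨_) (afF-tt (r k) t)
        (propagate-down (λ i → suffix w i ⊨ r i) (λ i → afF-sound w i (r i)) k<k′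
          (≡P-tt⇒⊨ (r k′) t′)))

  afG-ff : ∀ ψ → ψ ≡P ff → afG lem φ ψ ν ≡ G φ
  afG-ff ψ f with lem {ψ ≡P ff}
  ... | yes _ = refl
  ... | no ¬f = ⊥-elim (¬f f)

  afG-¬ff : ∀ ψ → ¬ ψ ≡P ff → afG lem φ ψ ν ≡ af ψ ν
  afG-¬ff ψ ¬f with lem {ψ ≡P ff}
  ... | yes f = ⊥-elim (¬f f)
  ... | no _ = refl

  afG-⇒P-G : ψ ⇒P G φ → afG lem φ ψ ν ⇒P G φ
  afG-⇒P-G {ψ = ψ} p with lem {ψ ≡P ff}
  ... | yes _ = ⇒P-refl
  ... | no _ = ⇒P-trans (af-mono p) (mk⇒P λ _ → proj₂ ∘ to T-∧)

  run-FG-⇒P-G : ∀ k → run (A-FGnu lem φ) w k ⇒P G φ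
  run-FG-⇒P-G zero = ⇒P-refl
  run-FG-⇒P-G (suc k) = afG-⇒P-G (run-FG-⇒P-G k)

  afG-complete : ∀ (w : Word Ap) k ψ → suffix w k ⊨ ψ → suffix w (suc k) ⊨ afG lem φ ψ (w k)
  afG-complete w k ψ s =
    subst (suffix w (suc k) ⊨_) (sym (afG-¬ff ψ (⊨⇒¬≡P-ff ψ s))) (to (⊨-suffix-af w k ψ) s)

  A-FGnu-recognizes : IsNu φ → Recognizes (CoBuchiAccepts (A-FGnu lem φ) ff) (L (F (G φ)))
  A-FGnu-recognizes {φ = φ} νφ w = mk⇔ accepts sound
    where
    r = run (A-FGnu lem φ) w
    accepts : w ⊨ F (G φ) → CoBuchiAccepts (A-FGnu lem φ) ff w
    accepts (p , g) with lem {∃[ k ] p ≤ k × r k ≡P ff}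
    ... | no none = p , λ k p≤k f → none (k , p≤k , f)
    ... | yes (k , p≤k , f) = suc k , λ j k<j → ⊨⇒¬≡P-ff (r j)
      (propagate-up (λ i → suffix w i ⊨ r i) (λ i → afG-complete w i (r i)) k<j restart)
      where
      restart : suffix w (suc k) ⊨ r (suc k)
      restart = subst (suffix w (suc k) ⊨_) (sym (afG-ff (r k) f)) (G-later w φ (m≤n⇒m≤1+n p≤k) g)
    sound : CoBuchiAccepts (A-FGnu lem φ) ff w → w ⊨ F (G φ)
    sound (m , h) with lem {suffix w m ⊨ G φ}
    ... | yes g = m , g
    ... | no ¬g with reaches-ff (alw νφ) ¬g
    ...   | n , e = ⊥-elim (h (m + n) (m≤m+n m n)
      (subst (_≡P ff) (sym no-restart) (⇒P-ff (afRun-mono (run-FG-⇒P-G m) n) e)))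
      where
      no-restart : r (m + n) ≡ afRun (r m) (suffix w m) n
      no-restart = run-follows-af (A-FGnu lem φ) w m n
        λ i _ → afG-¬ff (r (m + i)) (h (m + i) (m≤m+n m i))

proposition4p2 : (lem : ExcludedMiddle 0ℓ) →
    (∀ (n : ℕ) (φ : LTL (Fin n)) → IsMu φ →
        Recognizes (BuchiAccepts (A-mu φ) tt) (L φ)
      × Recognizes (BuchiAccepts (A-GFmu lem φ) tt) (L (G (F φ))))
    × (∀ (n : ℕ) (φ : LTL (Fin n)) → IsNu φ →
        Recognizes (CoBuchiAccepts (A-nu φ) ff) (L φ)
      × Recognizes (CoBuchiAccepts (A-FGnu lem φ) ff) (L (F (G φ))))
proposition4p2 lem =
    (λ _ _ μφ → A-mu-recognizes lem μφ , A-GFmu-recognizes lem μφ)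
  , (λ _ _ νφ → A-nu-recognizes lem νφ , A-FGnu-recognizes lem νφ)
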